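{- Let $n\geq 1$ and let $K_{2,n}$ be the complete bipartite graph with parts $\{v_0,v_1\}$ and $\{v_2,\ldots,v_{n+1}\}$, with sink $v_0$. Then $$\mathsf{Sto}(K_{2,n}) = \{(c_1,c_2,\ldots,c_{n+1}) : 0\leq c_1\leq n-1,\ c_2,\ldots,c_{n+1}\in\{0,1\},\ c_1\geq |\{j\in[2,n+1] : c_j=0\}|\}.$$
   Context: Let $G$ be a finite connected loop-free graph with a distinguished sink vertex $s$. A configuration assigns a non-negative integer $c(v)$ to each non-sink vertex $v$; it is stable if $c(v)<d(v)$ for every non-sink $v$, where $d(v)$ is the degree. For an orientation $\mathcal{O}$ of $G$ (a direction for each edge), $\mathrm{in}_{\mathcal{O}}(v)$ is the number of edges directed into $v$. A configuration $c$ is compatible with $\mathcal{O}$ if $\mathrm{in}_{\mathcal{O}}(v)\geq d(v)-c(v)$ for every non-sink $v$. The set $\mathsf{Sto}(G)$ of stochastically recurrent states is the set of stable configurations compatible with at least one orientation of $G$. We write $c_i=c(v_i)$ and $[a,b]=\{a,a+1,\ldots,b\}$. -}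

module Defs where

open import Data.Nat using (ℕ; zero; suc; _+_; _≤_; _<_; _∸_)
open import Data.Nat.Properties using (_≟_)
open import Data.Fin using (Fin; zero; suc)
open import Data.Fin.Properties using () renaming (_≟_ to _≟F_)
open import Data.List using (List; length; filter; map; _++_; allFin)
open import Data.Product using (_×_; _,_; proj₁; proj₂; Σ)
open import Data.Bool using (Bool; true; false; if_then_else_)

-- A finite (multi)graph with vertex set Fin (suc m); vertex zero is the sink,
-- the non-sink vertices are suc i for i : Fin m.  Edges are listed as
-- unordered pairs of endpoints (a list, so multi-edges are allowed).
record Graph : Set where
  field
    m     : ℕ
    edges : List (Fin (suc m) × Fin (suc m))
open Graph public

Vertex : Graph → Set
Vertex G = Fin (suc (m G))

deg : (G : Graph) → Vertex G → ℕ
deg G v = length (filter (λ e → proj₁ e ≟F v) (edges G))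
        + length (filter (λ e → proj₂ e ≟F v) (edges G))

EdgeIx : Graph → Set
EdgeIx G = Fin (length (edges G))

-- An orientation chooses a direction for every edge:
-- for edge (a , b), false means a → b and true means b → a.
Orientation : Graph → Set
Orientation G = EdgeIx G → Bool

edgeAt : (G : Graph) → EdgeIx G → Vertex G × Vertex G
edgeAt G k = Data.List.lookup (edges G) k

headOf : (G : Graph) → Orientation G → EdgeIx G → Vertex G
headOf G O k = if O k then proj₁ (edgeAt G k) else proj₂ (edgeAt G k)

inDeg : (G : Graph) → Orientation G → Vertex G → ℕ
inDeg G O v = length (filter (λ k → headOf G O k ≟F v) (allFin (length (edges G))))

Config : Graph → Set
Config G = Fin (m G) → ℕ

Stable : (G : Graph) → Config G → Set
Stable G c = ∀ i → c i < deg G (suc i)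

-- in_O(v) ≥ d(v) − c(v)  (integer inequality, written without truncated subtraction)
Compatible : (G : Graph) → Config G → Orientation G → Set
Compatible G c O = ∀ i → deg G (suc i) ≤ inDeg G O (suc i) + c i

Sto : (G : Graph) → Config G → Set
Sto G c = Stable G c × Σ (Orientation G) (λ O → Compatible G c O)

-- K_{2,n}: vertices v_0 = zero (sink), v_1 = suc zero, v_{j+2} = suc (suc j), j : Fin n.
-- Edges: v_0 – v_{j+2} and v_1 – v_{j+2} for every j.
K2 : ℕ → Graph
K2 n = record
  { m = suc n
  ; edges = map (λ j → (zero , suc (suc j))) (allFin n)
         ++ map (λ j → (suc zero , suc (suc j))) (allFin n)
  }

-- The explicit set from the proposition.  A configuration c : Fin (suc n) → ℕ
-- has c zero = c_1 and c (suc j) = c_{j+2}.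
zerosAmongLeaves : (n : ℕ) → (Fin (suc n) → ℕ) → ℕ
zerosAmongLeaves n c = length (filter (λ j → c (suc j) ≟ 0) (allFin n))

InSet : (n : ℕ) → (Fin (suc n) → ℕ) → Set
InSet n c = (c zero ≤ n ∸ 1)
          × (∀ j → c (suc j) ≤ 1)
          × (zerosAmongLeaves n c ≤ c zero)

{-# OPTIONS --safe #-}
module Submission where

-- Stability of K₂,ₙ says c₁ < n and cⱼ ≤ 1.  If c is compatible with O, summing
-- deg ≤ in + c over the non-sink vertices and using that the in-degrees add up to
-- the 2n edges gives n + 2n ≤ 2n + c₁ + Σⱼ cⱼ, so c₁ ≥ n − Σⱼ cⱼ, the number of
-- empty leaves.  Conversely, orient the edges at the sink towards the leaves and
-- the edge v₁vⱼ towards v₁ iff cⱼ = 1: every empty leaf then receives both of its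
-- edges, and v₁ receives n − #(empty leaves) ≥ n − c₁ edges.

open import Defs
open import Data.Nat using (ℕ; suc; _≤_)
open import Data.Fin using (Fin)
open import Function.Bundles using (_⇔_; mk⇔; Equivalence)

open import Data.Bool using (Bool; true; false; if_then_else_)
open import Data.Fin using (zero; suc)
open import Data.Fin.Properties using () renaming (_≟_ to _≟F_)
open import Data.List using (length; filter; map; _++_; allFin; tabulate)
open import Data.List.Properties
  using (filter-++; length-++; length-map; length-tabulate; map-tabulate; tabulate-lookup)
open import Data.Nat using (zero; _+_; _*_; _∸_; _<_; _<ᵇ_; z≤n; s≤s)
open import Data.Nat.Properties
  using ( _≟_; ≤-refl; ≤-trans; ≤-reflexive; +-mono-≤; +-monoˡ-≤; m≤m+n; m≤n+m; +-comm; +-identityʳ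
        ; *-identityʳ; *-comm; +-cancelˡ-≤; +-cancelʳ-≤; <⇒≤pred; +-0-commutativeMonoid; module ≤-Reasoning)
open import Algebra.Properties.CommutativeMonoid.Sum +-0-commutativeMonoid
  using (sum; sum-syntax; sum-cong-≗; sum-replicate-zero; ∑-distrib-+; ∑-comm)
open import Data.Product using (_×_; _,_; proj₁; proj₂)
open import Function using (_∘′_)
open import Level using (Level)
open import Relation.Binary.PropositionalEquality
  using (_≡_; refl; sym; trans; cong; cong₂; subst; module ≡-Reasoning)
open import Relation.Nullary using (Dec; does)
open import Relation.Nullary.Decidable using (dec-true)
open import Relation.Unary using (Pred; Decidable)

indicator : ∀ {p} {P : Set p} → Dec P → ℕ
indicator P? = if does P? then 1 else 0

indicator-yes : ∀ {p} {P : Set p} (P? : Dec P) → P → indicator P? ≡ 1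
indicator-yes P? p = cong (if_then 1 else 0) (dec-true P? p)

∑-const : ∀ n k → ∑[ i < n ] k ≡ n * k
∑-const zero    k = refl
∑-const (suc n) k = cong (k +_) (∑-const n k)

∑-ones : ∀ n → ∑[ i < n ] 1 ≡ n
∑-ones n = trans (∑-const n 1) (*-identityʳ n)

∑-mono-≤ : ∀ {n} {f g : Fin n → ℕ} → (∀ i → f i ≤ g i) → sum f ≤ sum g
∑-mono-≤ {zero}  f≤g = z≤n
∑-mono-≤ {suc n} f≤g = +-mono-≤ (f≤g zero) (∑-mono-≤ (λ i → f≤g (suc i)))

f≤∑f : ∀ {n} (f : Fin n → ℕ) i → f i ≤ sum f
f≤∑f f zero    = m≤m+n _ _
f≤∑f f (suc i) = ≤-trans (f≤∑f (λ j → f (suc j)) i) (m≤n+m _ _)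

∑-indicator-≟ˡ : ∀ {n} (a : Fin n) → ∑[ v < n ] indicator (a ≟F v) ≡ 1
∑-indicator-≟ˡ {suc n} zero    = cong suc (sum-replicate-zero n)
∑-indicator-≟ˡ         (suc a) = ∑-indicator-≟ˡ a

∑-indicator-≟ʳ : ∀ {n} (a : Fin n) → ∑[ v < n ] indicator (v ≟F a) ≡ 1
∑-indicator-≟ʳ {suc n} zero    = cong suc (sum-replicate-zero n)
∑-indicator-≟ʳ         (suc a) = ∑-indicator-≟ʳ a

module _ {a p : Level} {A : Set a} {P : Pred A p} (P? : Decidable P) where

  length-filter-tabulate : ∀ {n} (f : Fin n → A) →
                           length (filter P? (tabulate f)) ≡ ∑[ i < n ] indicator (P? (f i))
  length-filter-tabulate {zero}  f = refl
  length-filter-tabulate {suc n} f with does (P? (f zero))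
  ... | false = length-filter-tabulate (λ i → f (suc i))
  ... | true  = cong suc (length-filter-tabulate (λ i → f (suc i)))

  length-filter-++ : ∀ xs ys → length (filter P? (xs ++ ys)) ≡ length (filter P? xs) + length (filter P? ys)
  length-filter-++ xs ys = trans (cong length (filter-++ P? xs ys)) (length-++ (filter P? xs))

  length-filter-map-allFin : ∀ {n} (f : Fin n → A) →
                             length (filter P? (map f (allFin n))) ≡ ∑[ i < n ] indicator (P? (f i))
  length-filter-map-allFin f = trans (cong (length ∘′ filter P?) (map-tabulate (λ i → i) f)) (length-filter-tabulate f)


∑+#zeros≡n : ∀ {n} (f : Fin n → ℕ) → (∀ i → f i ≤ 1) →
             sum f + length (filter (λ i → f i ≟ 0) (allFin n)) ≡ n
∑+#zeros≡n {n} f f≤1 = begin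
  sum f + length (filter (λ i → f i ≟ 0) (allFin n))  ≡⟨ cong (sum f +_) (length-filter-tabulate (λ i → f i ≟ 0) (λ i → i)) ⟩
  sum f + ∑[ i < n ] indicator (f i ≟ 0)              ≡⟨ ∑-distrib-+ f _ ⟨
  ∑[ i < n ] (f i + indicator (f i ≟ 0))              ≡⟨ sum-cong-≗ (λ i → bit+isZero (f i) (f≤1 i)) ⟩
  ∑[ i < n ] 1                                        ≡⟨ ∑-ones n ⟩
  n                                                   ∎
  where
  open ≡-Reasoning
  bit+isZero : ∀ x → x ≤ 1 → x + indicator (x ≟ 0) ≡ 1
  bit+isZero 0             _           = refl
  bit+isZero 1             _           = refl
  bit+isZero (suc (suc x)) (s≤s ())

target : ∀ {a} {A : Set a} → Bool → A × A → A
target b (x , y) = if b then x else y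

orientBy : (G : Graph) → (Vertex G × Vertex G → Bool) → Orientation G
orientBy G h = h ∘′ edgeAt G

module _ (G : Graph) where

  inDeg-∑ : ∀ O v → inDeg G O v ≡ ∑[ k < length (edges G) ] indicator (headOf G O k ≟F v)
  inDeg-∑ O v = length-filter-tabulate (λ k → headOf G O k ≟F v) (λ k → k)

  ∑-inDeg : ∀ O → ∑[ v < suc (m G) ] inDeg G O v ≡ length (edges G)
  ∑-inDeg O = begin
    ∑[ v < suc (m G) ] inDeg G O v                                ≡⟨ sum-cong-≗ (inDeg-∑ O) ⟩
    ∑[ v < suc (m G) ] ∑[ k < E ] indicator (headOf G O k ≟F v)  ≡⟨ ∑-comm (λ v k → indicator (headOf G O k ≟F v)) ⟩
    ∑[ k < E ] ∑[ v < suc (m G) ] indicator (headOf G O k ≟F v)  ≡⟨ sum-cong-≗ (λ k → ∑-indicator-≟ˡ (headOf G O k)) ⟩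
    ∑[ k < E ] 1                                                  ≡⟨ ∑-ones E ⟩
    E                                                             ∎
    where
    open ≡-Reasoning
    E = length (edges G)

  Compatible⇒∑deg≤∣edges∣+∑c : ∀ {c O} → Compatible G c O →
                               ∑[ i < m G ] deg G (suc i) ≤ length (edges G) + sum c
  Compatible⇒∑deg≤∣edges∣+∑c {c} {O} compatible = begin
    ∑[ i < m G ] deg G (suc i)                            ≤⟨ ∑-mono-≤ compatible ⟩
    ∑[ i < m G ] (inDeg G O (suc i) + c i)                ≡⟨ ∑-distrib-+ (λ i → inDeg G O (suc i)) c ⟩
    ∑[ i < m G ] inDeg G O (suc i) + sum c                ≤⟨ +-monoˡ-≤ (sum c) (m≤n+m _ (inDeg G O zero)) ⟩
    ∑[ v < suc (m G) ] inDeg G O v + sum c                ≡⟨ cong (_+ sum c) (∑-inDeg O) ⟩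
    length (edges G) + sum c                              ∎
    where open ≤-Reasoning

  inDeg-orientBy : ∀ h v → inDeg G (orientBy G h) v ≡ length (filter (λ e → target (h e) e ≟F v) (edges G))
  inDeg-orientBy h v = begin
    inDeg G (orientBy G h) v                     ≡⟨ inDeg-∑ (orientBy G h) v ⟩
    ∑[ k < _ ] indicator (Q? (edgeAt G k))       ≡⟨ length-filter-tabulate Q? (edgeAt G) ⟨
    length (filter Q? (tabulate (edgeAt G)))     ≡⟨ cong (length ∘′ filter Q?) (tabulate-lookup (edges G)) ⟩
    length (filter Q? (edges G))                 ∎
    where
    open ≡-Reasoning
    Q? = λ e → target (h e) e ≟F v

length-filter-edges-K2 : ∀ n {p} {P : Pred (Vertex (K2 n) × Vertex (K2 n)) p} (P? : Decidable P) →
                         length (filter P? (edges (K2 n)))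
                           ≡ ∑[ j < n ] indicator (P? (zero , suc (suc j)))
                           + ∑[ j < n ] indicator (P? (suc zero , suc (suc j)))
length-filter-edges-K2 n P? = trans
  (length-filter-++ P? (map (λ j → zero , suc (suc j)) (allFin n)) (map (λ j → suc zero , suc (suc j)) (allFin n)))
  (cong₂ _+_ (length-filter-map-allFin P? (λ j → zero , suc (suc j)))
             (length-filter-map-allFin P? (λ j → suc zero , suc (suc j))))

length-edges-K2 : ∀ n → length (edges (K2 n)) ≡ n + n
length-edges-K2 n = trans (length-++ (map (λ j → zero , suc (suc j)) (allFin n)))
  (cong₂ _+_ (trans (length-map _ (allFin n)) (length-tabulate {n = n} (λ j → j)))
             (trans (length-map _ (allFin n)) (length-tabulate {n = n} (λ j → j))))

deg-K2-v₁ : ∀ n → deg (K2 n) (suc zero) ≡ n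
deg-K2-v₁ n = begin
  deg (K2 n) (suc zero)                          ≡⟨ cong₂ _+_ (length-filter-edges-K2 n _) (length-filter-edges-K2 n _) ⟩
  (∑[ j < n ] 0 + ∑[ j < n ] 1) + (∑[ j < n ] 0 + ∑[ j < n ] 0)
    ≡⟨ cong₂ _+_ (cong₂ _+_ (sum-replicate-zero n) (∑-ones n)) (cong₂ _+_ (sum-replicate-zero n) (sum-replicate-zero n)) ⟩
  n + 0                                          ≡⟨ +-identityʳ n ⟩
  n                                              ∎
  where open ≡-Reasoning

deg-K2-leaf : ∀ n j → deg (K2 n) (suc (suc j)) ≡ 2
deg-K2-leaf n j = trans (cong₂ _+_ (length-filter-edges-K2 n _) (length-filter-edges-K2 n _))
  (cong₂ _+_ (cong₂ _+_ (sum-replicate-zero n) (sum-replicate-zero n))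
             (cong₂ _+_ (∑-indicator-≟ʳ j) (∑-indicator-≟ʳ j)))

∑-deg-K2 : ∀ n → ∑[ i < suc n ] deg (K2 n) (suc i) ≡ n + (n + n)
∑-deg-K2 n = cong₂ _+_ (deg-K2-v₁ n) (begin
  ∑[ j < n ] deg (K2 n) (suc (suc j))  ≡⟨ sum-cong-≗ (deg-K2-leaf n) ⟩
  ∑[ j < n ] 2                         ≡⟨ ∑-const n 2 ⟩
  n * 2                                ≡⟨ *-comm n 2 ⟩
  n + (n + 0)                          ≡⟨ cong (n +_) (+-identityʳ n) ⟩
  n + n                                ∎)
  where open ≡-Reasoning

Stable-K2⇔ : ∀ {n} → 1 ≤ n → (c : Fin (suc n) → ℕ) →
             Stable (K2 n) c ⇔ (c zero ≤ n ∸ 1 × (∀ j → c (suc j) ≤ 1))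
Stable-K2⇔ {suc n} _ c = mk⇔
  (λ stable → <⇒≤pred (subst (c zero <_) (deg-K2-v₁ (suc n)) (stable zero))
            , λ j → <⇒≤pred (subst (c (suc j) <_) (deg-K2-leaf (suc n) j) (stable (suc j))))
  λ { (c₁≤n , cⱼ≤1) → λ
    { zero    → subst (c zero <_) (sym (deg-K2-v₁ (suc n))) (s≤s c₁≤n)
    ; (suc j) → subst (c (suc j) <_) (sym (deg-K2-leaf (suc n) j)) (s≤s (cⱼ≤1 j)) } }

Compatible-K2⇒n≤∑c : ∀ {n c O} → Compatible (K2 n) c O → n ≤ sum c
Compatible-K2⇒n≤∑c {n} {c} compatible = +-cancelˡ-≤ (n + n) n (sum c) (begin
  (n + n) + n                          ≡⟨ +-comm (n + n) n ⟩
  n + (n + n)                          ≡⟨ ∑-deg-K2 n ⟨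
  ∑[ i < suc n ] deg (K2 n) (suc i)    ≤⟨ Compatible⇒∑deg≤∣edges∣+∑c (K2 n) compatible ⟩
  length (edges (K2 n)) + sum c        ≡⟨ cong (_+ sum c) (length-edges-K2 n) ⟩
  (n + n) + sum c                      ∎)
  where open ≤-Reasoning

Sto⇒InSet : ∀ {n} → 1 ≤ n → (c : Fin (suc n) → ℕ) → Sto (K2 n) c → InSet n c
Sto⇒InSet {n} 1≤n c (stable , O , compatible) = c₁≤n-1 , cⱼ≤1 , zeros≤c₁
  where
  open ≤-Reasoning
  c₁≤n-1 = proj₁ (Equivalence.to (Stable-K2⇔ 1≤n c) stable)
  cⱼ≤1   = proj₂ (Equivalence.to (Stable-K2⇔ 1≤n c) stable)
  S = ∑[ j < n ] c (suc j)
  Z = zerosAmongLeaves n c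
  zeros≤c₁ : Z ≤ c zero
  zeros≤c₁ = +-cancelʳ-≤ S Z (c zero) (begin
    Z + S      ≡⟨ +-comm Z S ⟩
    S + Z      ≡⟨ ∑+#zeros≡n (λ j → c (suc j)) cⱼ≤1 ⟩
    n          ≤⟨ Compatible-K2⇒n≤∑c compatible ⟩
    c zero + S ∎)

module _ {n : ℕ} (c : Fin (suc n) → ℕ) where

  towardsV₁ : Vertex (K2 n) × Vertex (K2 n) → Bool
  towardsV₁ (suc zero , suc (suc j)) = 0 <ᵇ c (suc j)
  towardsV₁ _                        = false

  chipOrientation : Orientation (K2 n)
  chipOrientation = orientBy (K2 n) towardsV₁

  spokeHead : Fin n → Vertex (K2 n)
  spokeHead j = target (0 <ᵇ c (suc j)) (suc zero , suc (suc j))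

  inDeg-v₁ : inDeg (K2 n) chipOrientation (suc zero) ≡ ∑[ j < n ] indicator (spokeHead j ≟F suc zero)
  inDeg-v₁ = trans (trans (inDeg-orientBy (K2 n) towardsV₁ (suc zero)) (length-filter-edges-K2 n _))
                   (cong (_+ ∑[ j < n ] indicator (spokeHead j ≟F suc zero)) (sum-replicate-zero n))

  inDeg-leaf : ∀ j → inDeg (K2 n) chipOrientation (suc (suc j))
                       ≡ 1 + ∑[ i < n ] indicator (spokeHead i ≟F suc (suc j))
  inDeg-leaf j = trans (trans (inDeg-orientBy (K2 n) towardsV₁ (suc (suc j))) (length-filter-edges-K2 n _))
                       (cong (_+ ∑[ i < n ] indicator (spokeHead i ≟F suc (suc j))) (∑-indicator-≟ʳ j))

  ∑leaves≤inDeg-v₁ : (∀ j → c (suc j) ≤ 1) → ∑[ j < n ] c (suc j) ≤ inDeg (K2 n) chipOrientation (suc zero)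
  ∑leaves≤inDeg-v₁ cⱼ≤1 =
    ≤-trans (∑-mono-≤ (λ j → chip⇒intoV₁ j (c (suc j)) (cⱼ≤1 j))) (≤-reflexive (sym inDeg-v₁))
    where
    chip⇒intoV₁ : ∀ j x → x ≤ 1 → x ≤ indicator (target (0 <ᵇ x) (suc zero , suc (suc j)) ≟F suc zero)
    chip⇒intoV₁ j 0             _        = z≤n
    chip⇒intoV₁ j 1             _        = ≤-refl
    chip⇒intoV₁ j (suc (suc x)) (s≤s ())

  chipOrientation-compatible : (∀ j → c (suc j) ≤ 1) → zerosAmongLeaves n c ≤ c zero →
                               Compatible (K2 n) c chipOrientation
  chipOrientation-compatible cⱼ≤1 zeros≤c₁ zero = begin
    deg (K2 n) (suc zero)                                ≡⟨ deg-K2-v₁ n ⟩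
    n                                                    ≡⟨ ∑+#zeros≡n (λ j → c (suc j)) cⱼ≤1 ⟨
    ∑[ j < n ] c (suc j) + zerosAmongLeaves n c          ≤⟨ +-mono-≤ (∑leaves≤inDeg-v₁ cⱼ≤1) zeros≤c₁ ⟩
    inDeg (K2 n) chipOrientation (suc zero) + c zero     ∎
    where open ≤-Reasoning
  chipOrientation-compatible cⱼ≤1 zeros≤c₁ (suc j) = begin
    deg (K2 n) (suc (suc j))                             ≡⟨ deg-K2-leaf n j ⟩
    2                                                    ≤⟨ s≤s (chip-or-intoLeaf (c (suc j))) ⟩
    suc (intoLeaf (c (suc j)) + c (suc j))               ≤⟨ s≤s (+-monoˡ-≤ (c (suc j)) (f≤∑f intoLeafᵢ j)) ⟩
    suc (∑[ i < n ] intoLeafᵢ i + c (suc j))             ≡⟨ cong (_+ c (suc j)) (inDeg-leaf j) ⟨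
    inDeg (K2 n) chipOrientation (suc (suc j)) + c (suc j)  ∎
    where
    open ≤-Reasoning
    intoLeafᵢ : Fin n → ℕ
    intoLeafᵢ i = indicator (spokeHead i ≟F suc (suc j))
    intoLeaf : ℕ → ℕ
    intoLeaf x = indicator (target (0 <ᵇ x) (suc zero , suc (suc j)) ≟F suc (suc j))
    chip-or-intoLeaf : ∀ x → 1 ≤ intoLeaf x + x
    chip-or-intoLeaf zero    =
      ≤-reflexive (sym (trans (+-identityʳ _) (indicator-yes (suc (suc j) ≟F suc (suc j)) refl)))
    chip-or-intoLeaf (suc x) = ≤-trans (s≤s z≤n) (m≤n+m (suc x) (intoLeaf (suc x)))

InSet⇒Sto : ∀ {n} → 1 ≤ n → (c : Fin (suc n) → ℕ) → InSet n c → Sto (K2 n) c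
InSet⇒Sto 1≤n c (c₁≤n-1 , cⱼ≤1 , zeros≤c₁) =
    Equivalence.from (Stable-K2⇔ 1≤n c) (c₁≤n-1 , cⱼ≤1)
  , chipOrientation c
  , chipOrientation-compatible c cⱼ≤1 zeros≤c₁

proposition5 : (n : ℕ) → 1 ≤ n → (c : Fin (suc n) → ℕ) → Sto (K2 n) c ⇔ InSet n c
proposition5 n 1≤n c = mk⇔ (Sto⇒InSet 1≤n c) (InSet⇒Sto 1≤n c)
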